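{- Let $G$ be a bipartite graph with positive integer edge weights and without isolated nodes, let $M$ be a maximum weight matching of $G$, and let $u$ be a node of $G$ with copies $u^1,\ldots,u^\beta$ in the unfolded graph $\phi(G)$. If $\rho(u^i)=0$ for some $i$, then $\rho(u^j)=0$ for all $j\in[i,\beta]$; furthermore, there exist $\beta-i+1$ pairwise node-disjoint even-length alternating paths $P_i,P_{i+1},\ldots,P_\beta$ for $\phi(M)$, where each $P_j$ starts from $u^j$.
   Context: The unfolded graph $\phi(G)$: for each node $u$ of $G$, $\phi(G)$ has nodes $u^1,\ldots,u^\alpha$, where $\alpha$ is the weight of the heaviest edge of $G$ incident to $u$; for each edge $uv$ of $G$ with weight $\beta=w(u,v)$, $\phi(G)$ has edges $u^1v^\beta,u^2v^{\beta-1},\ldots,u^\beta v^1$. For a matching $M$ of $G$, $\phi(M)=\bigcup_{uv\in M}\{u^1v^{w(u,v)},\ldots,u^{w(u,v)}v^1\}$. A path in $\phi(G)$ is alternating for $\phi(M)$ if its edges alternate between being in $\phi(M)$ and not in $\phi(M)$, and, whenever its first (respectively last) node is matched by $\phi(M)$, the path contains that node's matched edge as its first (respectively last) edge. Its length is its number of edges; a length-zero alternating path consists of a single node unmatched by $\phi(M)$. For a node $u^i$ of $\phi(G)$, $\rho(u^i)=0$ if there is an even-length alternating path for $\phi(M)$ starting from $u^i$, and $\rho(u^i)=1$ otherwise. -}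

module Defs where

open import Data.Nat using (ℕ; zero; suc; _+_; _*_; _∸_; _≤_; _<_; _⊔_; _<ᵇ_)
open import Data.Fin using (Fin; toℕ)
open import Data.Bool using (Bool; true; false; _∧_; if_then_else_)
open import Data.List using (List; []; _∷_; _++_; map; foldr; allFin; length)
open import Data.Nat.ListAction using (sum)
open import Data.Unit using (⊤)
open import Data.Empty using (⊥)
open import Data.List.Relation.Unary.All using (All)
open import Data.List.Relation.Unary.Linked using (Linked)
open import Data.List.Relation.Unary.Unique.Propositional using (Unique)
open import Data.List.Membership.Propositional using (_∈_)
open import Data.Product using (Σ; ∃; _×_; _,_)
open import Data.Sum using (_⊎_)
open import Relation.Binary.PropositionalEquality using (_≡_; _≢_)
open import Relation.Nullary using (¬_)

-- Weighted bipartite graphs on the node set Fin n.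
-- w u v = 0 means "no edge"; an edge uv has positive integer weight w u v.

record WBGraph (n : ℕ) : Set where
  field
    w        : Fin n → Fin n → ℕ
    w-sym    : ∀ u v → w u v ≡ w v u
    side     : Fin n → Bool
    bipart   : ∀ u v → 0 < w u v → side u ≢ side v
    noIsol   : ∀ u → ∃ λ v → 0 < w u v
open WBGraph public

-- weight of the heaviest edge incident to u (= number of copies of u in φ(G))
α : ∀ {n} → WBGraph n → Fin n → ℕ
α {n} G u = foldr _⊔_ 0 (map (w G u) (allFin n))

record Matching {n : ℕ} (G : WBGraph n) : Set where
  field
    M       : Fin n → Fin n → Bool
    M-sym   : ∀ u v → M u v ≡ M v u
    M-edge  : ∀ u v → M u v ≡ true → 0 < w G u v
    M-uniq  : ∀ u v v' → M u v ≡ true → M u v' ≡ true → v ≡ v'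
open Matching public

weight : ∀ {n} {G : WBGraph n} → Matching G → ℕ
weight {n} {G} Mt =
  sum (map (λ u → sum (map (λ v → if M Mt u v ∧ (toℕ u <ᵇ toℕ v) then w G u v else 0)
                           (allFin n)))
           (allFin n))

IsMaxWeight : ∀ {n} (G : WBGraph n) → Matching G → Set
IsMaxWeight G Mt = ∀ (M' : Matching G) → weight M' ≤ weight Mt

-- The unfolded graph φ(G).  The node u^i is represented by the pair (u , i).

Node : ℕ → Set
Node n = Fin n × ℕ

ValidNode : ∀ {n} → WBGraph n → Node n → Set
ValidNode G (u , i) = 1 ≤ i × i ≤ α G u

PhiEdge : ∀ {n} → WBGraph n → Node n → Node n → Set
PhiEdge G (u , i) (v , j) = 0 < w G u v × 1 ≤ i × 1 ≤ j × i + j ≡ suc (w G u v)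

InPhiM : ∀ {n} {G : WBGraph n} → Matching G → Node n → Node n → Set
InPhiM {G = G} Mt (u , i) (v , j) =
  M Mt u v ≡ true × 1 ≤ i × 1 ≤ j × i + j ≡ suc (w G u v)

Alternates : ∀ {n} {G : WBGraph n} → Matching G → List (Node n) → Set
Alternates Mt (x ∷ y ∷ z ∷ rest) =
  ((InPhiM Mt x y × ¬ InPhiM Mt y z) ⊎ (¬ InPhiM Mt x y × InPhiM Mt y z))
  × Alternates Mt (y ∷ z ∷ rest)
Alternates Mt _ = ⊤

IsPhiPath : ∀ {n} → WBGraph n → List (Node n) → Set
IsPhiPath G p = All (ValidNode G) p × Unique p × Linked (PhiEdge G) p

IsAltPathFrom : ∀ {n} {G : WBGraph n} → Matching G → Node n → List (Node n) → Set
IsAltPathFrom {n} {G} Mt x p =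
  (Σ (List (Node n)) λ rest → p ≡ x ∷ rest)
  × IsPhiPath G p
  × Alternates Mt p
  × (∀ y → InPhiM Mt x y → Σ (List (Node n)) λ rest → p ≡ x ∷ y ∷ rest)
  × (∀ init z y → p ≡ init ++ (z ∷ []) → InPhiM Mt z y →
       Σ (List (Node n)) λ init' → p ≡ init' ++ (y ∷ z ∷ []))

Even : ℕ → Set
Even m = ∃ λ k → m ≡ k + k

pathLength : ∀ {A : Set} → List A → ℕ
pathLength p = length p ∸ 1

IsEvenAltPathFrom : ∀ {n} {G : WBGraph n} → Matching G → Node n → List (Node n) → Set
IsEvenAltPathFrom Mt x p = IsAltPathFrom Mt x p × Even (pathLength p)

-- ρ(x) = 0  iff  there is an even-length alternating path for φ(M) starting from x
ρ≡0 : ∀ {n} {G : WBGraph n} → Matching G → Node n → Set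
ρ≡0 {n} Mt x = Σ (List (Node n)) λ p → IsEvenAltPathFrom Mt x p

Disjoint : ∀ {n} → List (Node n) → List (Node n) → Set
Disjoint p q = ∀ x → x ∈ p → x ∈ q → ⊥

{-# OPTIONS --safe #-}
module Submission where

-- An even alternating path from u^i yields an alternating walk that starts with the matched edge
-- of u^i and ends at a free node. Shifting such a walk by δ (copies on the side of u move up by δ,
-- the others down by δ, and the walk is cut where a copy loses its matched edge) gives an
-- alternating walk from u^(i+δ); if the walk visits each node of G at most once, the shifts for
-- different δ are node-disjoint paths. A walk that revisits a node g of G, first at g^a and later
-- at g^a′, contains an alternating cycle of G whose unmatched and matched halves differ in weight
-- by a − a′. As M has maximum weight, a′ ≤ a, so the part of the walk after g^a′, shifted by
-- a − a′, is a walk from g^a that avoids the revisit.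

open import Defs
open import Data.Nat using (ℕ; zero; suc; _+_; _∸_; _≤_; _<_; _⊔_; _<ᵇ_; z≤n; s≤s; _≤?_)
open import Data.Nat.Properties hiding (_≟_)
open import Algebra.Properties.CommutativeSemigroup +-commutativeSemigroup using (x∙yz≈y∙xz)
open import Data.Nat.ListAction using (sum)
open import Algebra.Properties.CommutativeMonoid.Sum +-0-commutativeMonoid using (sum-syntax; ∑-distrib-+; sum-cong-≗; sum-replicate-zero) renaming (sum to ∑)
open import Data.Fin using (Fin; zero; suc; toℕ; _≟_)
open import Data.Fin.Properties using (toℕ-injective; any?)
open import Data.Bool using (Bool; true; false; _∧_; _∨_; if_then_else_; T)
open import Data.Bool.Properties using (∧-comm; ∨-comm; ∧-zeroʳ; ∧-conicalˡ; ∧-conicalʳ; ∨-zeroʳ; ¬-not) renaming (_≟_ to _≟ᵇ_)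
open import Data.List using (List; []; _∷_; _++_; map; foldr; allFin; tabulate; length)
open import Data.List.Properties using (map-tabulate; map-++; ++-assoc; ++-identityʳ; ∷-injectiveʳ; ∷ʳ-injective)
open import Data.List.Relation.Unary.All as All using (All; []; _∷_)
open import Data.List.Relation.Unary.All.Properties as Allₚ using (¬Any⇒All¬)
open import Data.List.Relation.Unary.AllPairs using ([]; _∷_)
open import Data.List.Relation.Unary.Any using (here; there)
open import Data.List.Relation.Unary.Linked using (Linked; []; [-]; _∷_)
open import Data.List.Relation.Unary.Unique.Propositional using (Unique)
open import Data.List.Relation.Unary.Unique.Propositional.Properties using (map⁻)
open import Data.List.Membership.Propositional using (_∈_; _∉_)
open import Data.List.Membership.Propositional.Properties using (∈-map⁺; ∈-map⁻; ∈-++⁻)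
open import Data.List.Relation.Binary.Subset.Propositional using (_⊆_)
open import Data.Product as Prod using (Σ; ∃; ∃₂; _×_; _,_; proj₁; proj₂; uncurry)
open import Data.Sum as Sum using (_⊎_; inj₁; inj₂)
open import Data.Unit using (tt)
open import Data.Empty using (⊥; ⊥-elim)
open import Function using (_∘_; id)
open import Relation.Nullary using (Dec; yes; no; does; ¬_; contradiction)
open import Relation.Nullary.Decidable using (dec-true)
open import Relation.Binary.PropositionalEquality

does-true⁻ : ∀ {A : Set} (a? : Dec A) → does a? ≡ true → A
does-true⁻ (yes a) _ = a

∨-true⁻ : ∀ {a b} → a ∨ b ≡ true → a ≡ true ⊎ b ≡ true
∨-true⁻ {true} _ = inj₁ refl
∨-true⁻ {false} e = inj₂ e

endpoints : ∀ {A : Set} → List (A × A) → List A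
endpoints [] = []
endpoints ((a , b) ∷ es) = a ∷ b ∷ endpoints es

Joins : ∀ {A : Set} → List (A × A) → A → A → Set
Joins es u v = (u , v) ∈ es ⊎ (v , u) ∈ es

∈endpoints⁻ : ∀ {A : Set} {u : A} es → u ∈ endpoints es → ∃ (Joins es u)
∈endpoints⁻ (_ ∷ _) (here refl) = _ , inj₁ (here refl)
∈endpoints⁻ (_ ∷ _) (there (here refl)) = _ , inj₂ (here refl)
∈endpoints⁻ (_ ∷ es) (there (there i)) = Prod.map₂ (Sum.map there there) (∈endpoints⁻ es i)

∈⇒∈endpoints : ∀ {A : Set} {a b : A} {es} → (a , b) ∈ es → a ∈ endpoints es × b ∈ endpoints es
∈⇒∈endpoints {es = _ ∷ _} (here refl) = here refl , there (here refl)
∈⇒∈endpoints {es = _ ∷ _} (there i) with ∈⇒∈endpoints i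
... | a∈ , b∈ = there (there a∈) , there (there b∈)

Unique-++⁻ : ∀ {A : Set} (xs : List A) {ys} → Unique (xs ++ ys) →
  Unique xs × Unique ys × (∀ {x} → x ∈ xs → x ∉ ys)
Unique-++⁻ [] u = [] , u , λ ()
Unique-++⁻ (x ∷ xs) (x∉ ∷ u) with Unique-++⁻ xs u
... | xs! , ys! , xs#ys = Allₚ.++⁻ˡ xs x∉ ∷ xs! , ys! , disjoint
  where
  disjoint : ∀ {z} → z ∈ x ∷ xs → z ∉ _
  disjoint (here refl) j = All.lookup (Allₚ.++⁻ʳ xs x∉) j refl
  disjoint (there i) = xs#ys i

Unique-rotate : ∀ {A : Set} {x : A} xs → Unique (x ∷ xs) → Unique (xs ++ x ∷ [])
Unique-rotate [] _ = [] ∷ []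
Unique-rotate (y ∷ xs) ((x≢y ∷ x∉) ∷ (y∉ ∷ u)) =
  Allₚ.∷ʳ⁺ y∉ (≢-sym x≢y) ∷ Unique-rotate xs (x∉ ∷ u)

Unique-∷∷ : ∀ {A : Set} {x y : A} {xs} → x ≢ y → x ∉ xs → y ∉ xs → Unique xs →
  Unique (x ∷ y ∷ xs)
Unique-∷∷ {xs = xs} x≢y x∉ y∉ u = (x≢y ∷ ¬Any⇒All¬ xs x∉) ∷ (¬Any⇒All¬ xs y∉ ∷ u)

Unique-proj₁⇒functional : ∀ {A B : Set} {p : List (A × B)} → Unique (map proj₁ p) →
  ∀ {a b b′} → (a , b) ∈ p → (a , b′) ∈ p → b ≡ b′
Unique-proj₁⇒functional _ (here refl) (here refl) = refl
Unique-proj₁⇒functional (a∉ ∷ _) (here refl) (there j) =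
  ⊥-elim (All.lookup a∉ (∈-map⁺ proj₁ j) refl)
Unique-proj₁⇒functional (a∉ ∷ _) (there i) (here refl) =
  ⊥-elim (All.lookup a∉ (∈-map⁺ proj₁ i) refl)
Unique-proj₁⇒functional (_ ∷ p!) (there i) (there j) = Unique-proj₁⇒functional p! i j

penultimate-injective : ∀ {A : Set} (xs ys : List A) {a b c d} →
  xs ++ a ∷ b ∷ [] ≡ ys ++ c ∷ d ∷ [] → a ≡ c
penultimate-injective xs ys {a} {b} {c} {d} eq =
  proj₂ (∷ʳ-injective xs ys (proj₁ (∷ʳ-injective (xs ++ a ∷ []) (ys ++ c ∷ []) eq′)))
  where
  eq′ : (xs ++ a ∷ []) ++ b ∷ [] ≡ (ys ++ c ∷ []) ++ d ∷ []
  eq′ = trans (++-assoc xs _ _) (trans eq (sym (++-assoc ys _ _)))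

m+n≡1+o⇒m≤o : ∀ m {n o} → 1 ≤ n → m + n ≡ suc o → m ≤ o
m+n≡1+o⇒m≤o m {suc n} _ eq = subst (m ≤_) (suc-injective (trans (sym (+-suc m n)) eq)) (m≤m+n m n)

Odd : ℕ → Set
Odd m = ∃ λ k → m ≡ suc (k + k)

Even-suc⇒Odd : ∀ {m} → Even (suc m) → Odd m
Even-suc⇒Odd (zero , ())
Even-suc⇒Odd (suc k , eq) = k , trans (suc-injective eq) (+-suc k k)

m≡n+o∧n≡m+p⇒o≡p : ∀ {c k δ δ′} → c ≡ k + δ → k ≡ c + δ′ → δ ≡ δ′
m≡n+o∧n≡m+p⇒o≡p {c} {k} {δ} {δ′} c≡k+δ k≡c+δ′ =
  trans (m+n≡0⇒n≡0 δ′ sum≡0) (sym (m+n≡0⇒m≡0 δ′ sum≡0))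
  where
  sum≡0 : δ′ + δ ≡ 0
  sum≡0 = sym (+-cancelˡ-≡ c 0 (δ′ + δ)
            (trans (+-identityʳ c) (trans c≡k+δ (trans (cong (_+ δ) k≡c+δ′) (+-assoc c δ′ δ)))))

≢∧≢⇒≡ : ∀ {a b c : Bool} → a ≢ b → b ≢ c → a ≡ c
≢∧≢⇒≡ a≢b b≢c = trans (¬-not a≢b) (sym (¬-not (≢-sym b≢c)))

sum-allFin : ∀ {m} (f : Fin m → ℕ) → sum (map f (allFin m)) ≡ ∑[ i < m ] f i
sum-allFin f = trans (cong sum (map-tabulate id f)) (sum-tabulate f)
  where
  sum-tabulate : ∀ {m} (f : Fin m → ℕ) → sum (tabulate f) ≡ ∑[ i < m ] f i
  sum-tabulate {zero} f = refl
  sum-tabulate {suc m} f = cong (f zero +_) (sum-tabulate (f ∘ suc))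

indicator : ∀ {m} → Fin m → Fin m → ℕ → ℕ
indicator a u K = if does (u ≟ a) then K else 0

∑-indicator : ∀ {m} (a : Fin m) K → ∑[ u < m ] indicator a u K ≡ K
∑-indicator {suc m} zero K = trans (cong (K +_) (sum-replicate-zero m)) (+-identityʳ K)
∑-indicator {suc m} (suc a) K = ∑-indicator a K

module MatchingWeight {n : ℕ} (G : WBGraph n) where

  open import Data.List.Membership.DecPropositional (_≟_ {n}) using (_∈?_; _∉?_)

  BoolRel : Set
  BoolRel = Fin n → Fin n → Bool

  _∪_ : BoolRel → BoolRel → BoolRel
  (R ∪ R′) u v = R u v ∨ R′ u v

  DisjointRel : BoolRel → BoolRel → Set
  DisjointRel R R′ = ∀ u v → R u v ∧ R′ u v ≡ false

  edgeWeight : BoolRel → Fin n → Fin n → ℕ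
  edgeWeight R u v = if R u v ∧ (toℕ u <ᵇ toℕ v) then w G u v else 0

  relWeight : BoolRel → ℕ
  relWeight R = ∑[ u < n ] ∑[ v < n ] edgeWeight R u v

  weight≡relWeight : (Mt : Matching G) → weight Mt ≡ relWeight (M Mt)
  weight≡relWeight Mt =
    trans (sum-allFin (λ u → sum (map (edgeWeight (M Mt) u) (allFin n))))
          (sum-cong-≗ (λ u → sum-allFin (edgeWeight (M Mt) u)))

  relWeight-cong : ∀ {R R′} → (∀ u v → R u v ≡ R′ u v) → relWeight R ≡ relWeight R′
  relWeight-cong R≗R′ = sum-cong-≗ λ u → sum-cong-≗ λ v →
    cong (λ b → if b ∧ (toℕ u <ᵇ toℕ v) then w G u v else 0) (R≗R′ u v)

  relWeight-∪ : ∀ R R′ → DisjointRel R R′ → relWeight (R ∪ R′) ≡ relWeight R + relWeight R′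
  relWeight-∪ R R′ R#R′ =
    trans (sum-cong-≗ λ u → trans (sum-cong-≗ (pointwise u))
                                  (∑-distrib-+ (edgeWeight R u) (edgeWeight R′ u)))
          (∑-distrib-+ (λ u → ∑[ v < n ] edgeWeight R u v) (λ u → ∑[ v < n ] edgeWeight R′ u v))
    where
    pointwise : ∀ u v → edgeWeight (R ∪ R′) u v ≡ edgeWeight R u v + edgeWeight R′ u v
    pointwise u v with R u v | R′ u v | toℕ u <ᵇ toℕ v | R#R′ u v
    ... | true  | true  | _     | ()
    ... | true  | false | true  | _ = sym (+-identityʳ _)
    ... | true  | false | false | _ = refl
    ... | false | _     | true  | _ = refl
    ... | false | _     | false | _ = refl

  arc : Fin n → Fin n → BoolRel
  arc a b u v = does (u ≟ a) ∧ does (v ≟ b)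

  edge : Fin n → Fin n → BoolRel
  edge a b = arc a b ∪ arc b a

  relWeight-arc : ∀ a b → relWeight (arc a b) ≡ (if toℕ a <ᵇ toℕ b then w G a b else 0)
  relWeight-arc a b = begin
    relWeight (arc a b)                       ≡⟨ sum-cong-≗ (λ u → sum-cong-≗ (pointwise u)) ⟩
    ∑[ u < n ] ∑[ v < n ] indicator a u (indicator b v K) ≡⟨ sum-cong-≗ inner ⟩
    ∑[ u < n ] indicator a u K                ≡⟨ ∑-indicator a K ⟩
    K                                         ∎
    where
    open ≡-Reasoning
    K : ℕ
    K = if toℕ a <ᵇ toℕ b then w G a b else 0
    pointwise : ∀ u v → edgeWeight (arc a b) u v ≡ indicator a u (indicator b v K)
    pointwise u v with u ≟ a | v ≟ b
    ... | yes refl | yes refl = refl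
    ... | yes refl | no _     = refl
    ... | no _     | _        = refl
    inner : ∀ u → ∑[ v < n ] indicator a u (indicator b v K) ≡ indicator a u K
    inner u with does (u ≟ a)
    ... | true  = ∑-indicator b K
    ... | false = sum-replicate-zero n

  relWeight-edge : ∀ {a b} → a ≢ b → relWeight (edge a b) ≡ w G a b
  relWeight-edge {a} {b} a≢b = begin
    relWeight (edge a b)                      ≡⟨ relWeight-∪ (arc a b) (arc b a) opposite ⟩
    relWeight (arc a b) + relWeight (arc b a) ≡⟨ cong₂ _+_ (relWeight-arc a b) (relWeight-arc b a) ⟩
    (if toℕ a <ᵇ toℕ b then w G a b else 0) + (if toℕ b <ᵇ toℕ a then w G b a else 0)
                                              ≡⟨ one-orientation ⟩
    w G a b                                   ∎
    where
    open ≡-Reasoning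
    opposite : DisjointRel (arc a b) (arc b a)
    opposite u v with u ≟ a | u ≟ b
    ... | yes refl | yes refl = contradiction refl a≢b
    ... | yes _    | no _     = ∧-zeroʳ _
    ... | no _     | _        = refl
    <ᵇ-true : ∀ x y → (x <ᵇ y) ≡ true → x < y
    <ᵇ-true x y e = <ᵇ⇒< x y (subst T (sym e) _)
    <ᵇ-false : ∀ x y → (x <ᵇ y) ≡ false → y ≤ x
    <ᵇ-false x y e = ≮⇒≥ (λ x<y → subst T e (<⇒<ᵇ x<y))
    one-orientation : (if toℕ a <ᵇ toℕ b then w G a b else 0) + (if toℕ b <ᵇ toℕ a then w G b a else 0)
                      ≡ w G a b
    one-orientation with toℕ a <ᵇ toℕ b in a<b | toℕ b <ᵇ toℕ a in b<a
    ... | true  | true  = ⊥-elim (<-asym (<ᵇ-true (toℕ a) (toℕ b) a<b) (<ᵇ-true (toℕ b) (toℕ a) b<a))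
    ... | true  | false = +-identityʳ _
    ... | false | true  = w-sym G b a
    ... | false | false =
      contradiction (toℕ-injective (≤-antisym (<ᵇ-false (toℕ b) (toℕ a) b<a) (<ᵇ-false (toℕ a) (toℕ b) a<b)))
                    a≢b

  Edges : Set
  Edges = List (Fin n × Fin n)

  edges : Edges → BoolRel
  edges [] u v = false
  edges ((a , b) ∷ es) = edge a b ∪ edges es

  totalWeight : Edges → ℕ
  totalWeight es = sum (map (uncurry (w G)) es)

  edge-true⁻ : ∀ a b u v → edge a b u v ≡ true → (u , v) ≡ (a , b) ⊎ (v , u) ≡ (a , b)
  edge-true⁻ a b u v e with u ≟ a | v ≟ b | u ≟ b | v ≟ a | e
  ... | yes refl | yes refl | _        | _        | _ = inj₁ refl
  ... | _        | _        | yes refl | yes refl | _ = inj₂ refl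
  ... | yes _    | no _     | yes _    | no _     | ()
  ... | yes _    | no _     | no _     | _        | ()
  ... | no _     | _        | yes _    | no _     | ()
  ... | no _     | _        | no _     | _        | ()

  edge-true⁺ : ∀ a b → edge a b a b ≡ true
  edge-true⁺ a b rewrite dec-true (a ≟ a) refl | dec-true (b ≟ b) refl = refl

  edges-sym : ∀ es u v → edges es u v ≡ edges es v u
  edges-sym [] u v = refl
  edges-sym ((a , b) ∷ es) u v = cong₂ _∨_ edge-sym (edges-sym es u v)
    where
    edge-sym : edge a b u v ≡ edge a b v u
    edge-sym = trans (cong₂ _∨_ (∧-comm (does (u ≟ a)) _) (∧-comm (does (u ≟ b)) _))
                     (∨-comm (arc b a v u) _)

  edges-true⁻ : ∀ es {u v} → edges es u v ≡ true → Joins es u v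
  edges-true⁻ ((a , b) ∷ es) {u} {v} e with ∨-true⁻ e
  ... | inj₁ h with edge-true⁻ a b u v h
  ...   | inj₁ refl = inj₁ (here refl)
  ...   | inj₂ refl = inj₂ (here refl)
  edges-true⁻ ((a , b) ∷ es) e | inj₂ t with edges-true⁻ es t
  ...   | inj₁ i = inj₁ (there i)
  ...   | inj₂ i = inj₂ (there i)

  edges-true⁺ : ∀ {es u v} → (u , v) ∈ es → edges es u v ≡ true
  edges-true⁺ {(a , b) ∷ es} (here refl) rewrite edge-true⁺ a b = refl
  edges-true⁺ {(a , b) ∷ es} {u} {v} (there i) rewrite edges-true⁺ {es} i = ∨-zeroʳ (edge a b u v)

  edges-true⇒endpoint : ∀ es {u v} → edges es u v ≡ true → u ∈ endpoints es
  edges-true⇒endpoint es e with edges-true⁻ es e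
  ... | inj₁ i = proj₁ (∈⇒∈endpoints i)
  ... | inj₂ i = proj₂ (∈⇒∈endpoints i)

  head-edge-fresh : ∀ {a b} es u v v′ → Unique (endpoints ((a , b) ∷ es)) →
    edge a b u v ≡ true → edges es u v′ ≡ true → ⊥
  head-edge-fresh {a} {b} es u v v′ ((_ ∷ a∉) ∷ (b∉ ∷ _)) h t with edge-true⁻ a b u v h
  ... | inj₁ refl = All.lookup a∉ (edges-true⇒endpoint es t) refl
  ... | inj₂ refl = All.lookup b∉ (edges-true⇒endpoint es t) refl

  edges-functional : ∀ es {u v v′} → Unique (endpoints es) →
    edges es u v ≡ true → edges es u v′ ≡ true → v ≡ v′
  edges-functional ((a , b) ∷ es) {u} {v} {v′} ab∷es!@((a≢b ∷ _) ∷ _) e e′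
    with ∨-true⁻ e | ∨-true⁻ e′
  ... | inj₁ h | inj₁ h′ with edge-true⁻ a b u v h | edge-true⁻ a b u v′ h′
  ...   | inj₁ refl | inj₁ refl = refl
  ...   | inj₁ refl | inj₂ refl = contradiction refl a≢b
  ...   | inj₂ refl | inj₁ refl = contradiction refl a≢b
  ...   | inj₂ refl | inj₂ refl = refl
  edges-functional (_ ∷ es) {u} {v} {v′} ab∷es! _ _ | inj₁ h | inj₂ t′ =
    ⊥-elim (head-edge-fresh es u v v′ ab∷es! h t′)
  edges-functional (_ ∷ es) {u} {v} {v′} ab∷es! _ _ | inj₂ t | inj₁ h′ =
    ⊥-elim (head-edge-fresh es u v′ v ab∷es! h′ t)
  edges-functional (_ ∷ es) (_ ∷ (_ ∷ es!)) _ _ | inj₂ t | inj₂ t′ = edges-functional es es! t t′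

  relWeight-edges : ∀ es → Unique (endpoints es) → relWeight (edges es) ≡ totalWeight es
  relWeight-edges [] _ = trans (sum-cong-≗ {n} (λ u → sum-replicate-zero n)) (sum-replicate-zero n)
  relWeight-edges ((a , b) ∷ es) ab∷es!@((a≢b ∷ _) ∷ (_ ∷ es!)) = begin
    relWeight (edge a b ∪ edges es)             ≡⟨ relWeight-∪ (edge a b) (edges es) disjoint ⟩
    relWeight (edge a b) + relWeight (edges es) ≡⟨ cong₂ _+_ (relWeight-edge a≢b) (relWeight-edges es es!) ⟩
    w G a b + totalWeight es                    ∎
    where
    open ≡-Reasoning
    disjoint : DisjointRel (edge a b) (edges es)
    disjoint u v with edge a b u v in h | edges es u v in t
    ... | true  | true  = ⊥-elim (head-edge-fresh es u v v ab∷es! h t)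
    ... | true  | false = refl
    ... | false | _     = refl

  module Exchange (Mt : Matching G) (Ps Ns : Edges)
                  (Ps⊆M : All (λ e → uncurry (M Mt) e ≡ true) Ps)
                  (Ns⊆E : All (λ e → 0 < uncurry (w G) e) Ns)
                  (Ps-unique : Unique (endpoints Ps)) (Ns-unique : Unique (endpoints Ns))
                  (Ns⊆Ps : endpoints Ns ⊆ endpoints Ps) where

    C : List (Fin n)
    C = endpoints Ps

    Mᵣ : BoolRel
    Mᵣ u v = M Mt u v ∧ (does (u ∉? C) ∧ does (v ∉? C))

    Mᵣ-true⁻ : ∀ {u v} → Mᵣ u v ≡ true → M Mt u v ≡ true × u ∉ C
    Mᵣ-true⁻ {u} {v} e =
      ∧-conicalˡ _ _ e , does-true⁻ (u ∉? C) (∧-conicalˡ _ (does (v ∉? C)) (∧-conicalʳ (M Mt u v) _ e))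

    Mᵣ-off : ∀ es → endpoints es ⊆ C → DisjointRel Mᵣ (edges es)
    Mᵣ-off es es⊆C u v with Mᵣ u v in r | edges es u v in t
    ... | true  | true  = contradiction (es⊆C (edges-true⇒endpoint es t)) (proj₂ (Mᵣ-true⁻ r))
    ... | true  | false = refl
    ... | false | _     = refl

    Ps-matched : ∀ {u v} → edges Ps u v ≡ true → M Mt u v ≡ true
    Ps-matched e with edges-true⁻ Ps e
    ... | inj₁ i = All.lookup Ps⊆M i
    ... | inj₂ i = trans (M-sym Mt _ _) (All.lookup Ps⊆M i)

    partner-in-Ps : ∀ {u v} → M Mt u v ≡ true → u ∈ C → edges Ps u v ≡ true
    partner-in-Ps {u} {v} m u∈C with ∈endpoints⁻ Ps u∈C
    ... | v′ , inj₁ i rewrite M-uniq Mt u v v′ m (All.lookup Ps⊆M i) = edges-true⁺ i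
    ... | v′ , inj₂ i rewrite M-uniq Mt u v v′ m (trans (M-sym Mt u v′) (All.lookup Ps⊆M i)) =
      trans (edges-sym Ps u v′) (edges-true⁺ i)

    M-split : ∀ u v → M Mt u v ≡ (Mᵣ ∪ edges Ps) u v
    M-split u v with M Mt u v in m
    ... | false with edges Ps u v in p
    ...   | true  = contradiction (trans (sym (Ps-matched p)) m) λ ()
    ...   | false = refl
    M-split u v | true with u ∈? C | v ∈? C
    ...   | yes u∈C | _       = sym (partner-in-Ps m u∈C)
    ...   | no _    | yes v∈C = sym (trans (edges-sym Ps u v) (partner-in-Ps (trans (M-sym Mt v u) m) v∈C))
    ...   | no _    | no _    = refl

    M′ : BoolRel
    M′ = Mᵣ ∪ edges Ns

    M′-sym : ∀ u v → M′ u v ≡ M′ v u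
    M′-sym u v = cong₂ _∨_ (cong₂ _∧_ (M-sym Mt u v) (∧-comm (does (u ∉? C)) _)) (edges-sym Ns u v)

    M′-edge : ∀ u v → M′ u v ≡ true → 0 < w G u v
    M′-edge u v e with ∨-true⁻ e
    ... | inj₁ r = M-edge Mt u v (proj₁ (Mᵣ-true⁻ r))
    ... | inj₂ t with edges-true⁻ Ns t
    ...   | inj₁ i = All.lookup Ns⊆E i
    ...   | inj₂ i = subst (0 <_) (w-sym G v u) (All.lookup Ns⊆E i)

    M′-uniq : ∀ u v v′ → M′ u v ≡ true → M′ u v′ ≡ true → v ≡ v′
    M′-uniq u v v′ e e′ with ∨-true⁻ e | ∨-true⁻ e′
    ... | inj₁ r | inj₁ r′ = M-uniq Mt u v v′ (proj₁ (Mᵣ-true⁻ r)) (proj₁ (Mᵣ-true⁻ r′))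
    ... | inj₁ r | inj₂ t′ = contradiction (Ns⊆Ps (edges-true⇒endpoint Ns t′)) (proj₂ (Mᵣ-true⁻ r))
    ... | inj₂ t | inj₁ r′ = contradiction (Ns⊆Ps (edges-true⇒endpoint Ns t)) (proj₂ (Mᵣ-true⁻ r′))
    ... | inj₂ t | inj₂ t′ = edges-functional Ns Ns-unique t t′

    exchanged : Matching G
    exchanged = record { M = M′ ; M-sym = M′-sym ; M-edge = M′-edge ; M-uniq = M′-uniq }

    weight-before : weight Mt ≡ relWeight Mᵣ + totalWeight Ps
    weight-before = begin
      weight Mt                               ≡⟨ weight≡relWeight Mt ⟩
      relWeight (M Mt)                        ≡⟨ relWeight-cong M-split ⟩
      relWeight (Mᵣ ∪ edges Ps)               ≡⟨ relWeight-∪ Mᵣ (edges Ps) (Mᵣ-off Ps id) ⟩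
      relWeight Mᵣ + relWeight (edges Ps)     ≡⟨ cong (relWeight Mᵣ +_) (relWeight-edges Ps Ps-unique) ⟩
      relWeight Mᵣ + totalWeight Ps           ∎
      where open ≡-Reasoning

    weight-after : weight exchanged ≡ relWeight Mᵣ + totalWeight Ns
    weight-after = begin
      weight exchanged                        ≡⟨ weight≡relWeight exchanged ⟩
      relWeight (Mᵣ ∪ edges Ns)               ≡⟨ relWeight-∪ Mᵣ (edges Ns) (Mᵣ-off Ns Ns⊆Ps) ⟩
      relWeight Mᵣ + relWeight (edges Ns)     ≡⟨ cong (relWeight Mᵣ +_) (relWeight-edges Ns Ns-unique) ⟩
      relWeight Mᵣ + totalWeight Ns           ∎
      where open ≡-Reasoning

    totalWeight-≤ : IsMaxWeight G Mt → totalWeight Ns ≤ totalWeight Ps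
    totalWeight-≤ max = +-cancelˡ-≤ (relWeight Mᵣ) _ _
      (subst₂ _≤_ weight-after weight-before (max exchanged))

module Unfolded {n : ℕ} (G : WBGraph n) (Mt : Matching G) where

  w≤α : ∀ u v → w G u v ≤ α G u
  w≤α u v =
    subst (w G u v ≤_) (cong (foldr _⊔_ 0) (sym (map-tabulate id (w G u)))) (≤-⊔-tabulate (w G u) v)
    where
    ≤-⊔-tabulate : ∀ {m} (f : Fin m → ℕ) i → f i ≤ foldr _⊔_ 0 (tabulate f)
    ≤-⊔-tabulate f zero = m≤m⊔n (f zero) _
    ≤-⊔-tabulate f (suc i) = m≤n⇒m≤o⊔n (f zero) (≤-⊔-tabulate (λ j → f (suc j)) i)

  InPhiM-sym : ∀ {x y} → InPhiM Mt x y → InPhiM Mt y x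
  InPhiM-sym {u , i} {v , j} (m , 1≤i , 1≤j , eq) =
    trans (M-sym Mt v u) m , 1≤j , 1≤i , trans (+-comm j i) (trans eq (cong suc (w-sym G u v)))

  InPhiM-functional : ∀ {x y y′} → InPhiM Mt x y → InPhiM Mt x y′ → y ≡ y′
  InPhiM-functional {u , i} {v , j} {v′ , j′} (m , _ , _ , eq) (m′ , _ , _ , eq′)
    with M-uniq Mt u v v′ m m′
  ... | refl = cong (v ,_) (+-cancelˡ-≡ i j j′ (trans eq (sym eq′)))

  InPhiM⇒PhiEdge : ∀ {x y} → InPhiM Mt x y → PhiEdge G x y
  InPhiM⇒PhiEdge {u , _} {v , _} (m , rest) = M-edge Mt u v m , rest

  InPhiM⇒valid : ∀ {x y} → InPhiM Mt x y → ValidNode G x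
  InPhiM⇒valid {u , i} {v , _} (_ , 1≤i , 1≤j , eq) =
    1≤i , ≤-trans (m+n≡1+o⇒m≤o i 1≤j eq) (w≤α u v)

  PhiEdge⇒validʳ : ∀ {x y} → PhiEdge G x y → ValidNode G y
  PhiEdge⇒validʳ {u , i} {v , j} (_ , 1≤i , 1≤j , eq) =
    1≤j , ≤-trans (m+n≡1+o⇒m≤o j 1≤i (trans (+-comm j i) (trans eq (cong suc (w-sym G u v)))))
                  (w≤α v u)

  InPhiM-shift : ∀ {g h a b} δ → InPhiM Mt (g , a) (h , b) → a + δ ≤ w G g h →
    δ < b × InPhiM Mt (g , a + δ) (h , b ∸ δ)
  InPhiM-shift {g} {h} {a} {b} δ (m , 1≤a , _ , eq) a+δ≤w =
    δ<b , m , ≤-trans 1≤a (m≤m+n a δ) , m<n⇒0<n∸m δ<b ,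
    trans (trans (+-assoc a δ (b ∸ δ)) (cong (a +_) (m+[n∸m]≡n (<⇒≤ δ<b)))) eq
    where
    δ<b : δ < b
    δ<b = +-cancelˡ-< a δ b (subst (a + δ <_) (sym eq) (s≤s a+δ≤w))

  PhiEdge-shift : ∀ {h g b c} δ → PhiEdge G (h , b) (g , c) → δ < b → PhiEdge G (h , b ∸ δ) (g , c + δ)
  PhiEdge-shift {b = b} {c} δ (hg , _ , 1≤c , eq) δ<b =
    hg , m<n⇒0<n∸m δ<b , ≤-trans 1≤c (m≤m+n c δ) , trans sum-kept eq
    where
    sum-kept : b ∸ δ + (c + δ) ≡ b + c
    sum-kept = trans (cong (b ∸ δ +_) (+-comm c δ))
                 (trans (sym (+-assoc (b ∸ δ) δ c)) (cong (_+ c) (m∸n+n≡m (<⇒≤ δ<b))))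

  unmatched-edge : ∀ {g h a b a′ b′} → PhiEdge G (g , a) (h , b) → ¬ InPhiM Mt (g , a) (h , b) →
    ¬ InPhiM Mt (g , a′) (h , b′)
  unmatched-edge (_ , 1≤a , 1≤b , eq) ¬m (m , _) = ¬m (m , 1≤a , 1≤b , eq)

  Free : Node n → Set
  Free x = ∀ y → ¬ InPhiM Mt x y

  free-above : ∀ {g h c} → M Mt g h ≡ true → w G g h < c → Free (g , c)
  free-above {g} {h} {c} m w<c (v , j) (m′ , _ , 1≤j , eq) rewrite M-uniq Mt g h v m m′ =
    <⇒≱ w<c (m+n≡1+o⇒m≤o c 1≤j eq)

  free-shift : ∀ {g a} δ → 1 ≤ a → Free (g , a) → Free (g , a + δ)
  free-shift {g} {a} δ 1≤a free (v , j) (m , _ , 1≤j , eq) =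
    free (v , j + δ) (m , 1≤a , ≤-trans 1≤j (m≤m+n j δ) , trans (shuffle a j δ) eq)
    where
    shuffle : ∀ a j δ → a + (j + δ) ≡ a + δ + j
    shuffle a j δ = trans (cong (a +_) (+-comm j δ)) (sym (+-assoc a δ j))

  free? : ∀ x → Free x ⊎ ∃ (InPhiM Mt x)
  free? (u , i) with any? (λ v → M Mt u v ≟ᵇ true)
  ... | no unmatched = inj₁ λ (v , _) (m , _) → unmatched (v , m)
  ... | yes (v , m) with 1 ≤? i | i ≤? w G u v
  ...   | no ¬1≤i | _      = inj₁ λ _ (_ , 1≤i , _) → ¬1≤i 1≤i
  ...   | yes _   | no i≰w = inj₁ (free-above m (≰⇒> i≰w))
  ...   | yes 1≤i | yes i≤w =
    inj₂ ((v , suc (w G u v) ∸ i) , m , 1≤i , 1≤partner , m+[n∸m]≡n (m≤n⇒m≤1+n i≤w))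
    where
    1≤partner : 1 ≤ suc (w G u v) ∸ i
    1≤partner = subst (1 ≤_) (sym (+-∸-assoc 1 i≤w)) (s≤s z≤n)

  PhiEdge-sides : ∀ {x y} → PhiEdge G x y → side G (proj₁ x) ≢ side G (proj₁ y)
  PhiEdge-sides {u , _} {v , _} (uv , _) = bipart G u v uv

  InPhiM-sides : ∀ {x y} → InPhiM Mt x y → side G (proj₁ x) ≢ side G (proj₁ y)
  InPhiM-sides m = PhiEdge-sides (InPhiM⇒PhiEdge m)

module Alternating {n : ℕ} (G : WBGraph n) (Mt : Matching G) where
  open Unfolded G Mt

  -- Unlike an alternating path, an alternating walk may repeat nodes.
  data AltWalk : Node n → List (Node n) → Set where
    stop : ∀ {x} → ValidNode G x → Free x → AltWalk x (x ∷ [])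
    step : ∀ {x y z p} → InPhiM Mt x y → PhiEdge G y z → ¬ InPhiM Mt y z → AltWalk z p →
           AltWalk x (x ∷ y ∷ p)

  AltWalk-head-∈ : ∀ {x p} → AltWalk x p → x ∈ p
  AltWalk-head-∈ (stop _ _) = here refl
  AltWalk-head-∈ (step _ _ _ _) = here refl

  AltWalk-valid : ∀ {x p} → AltWalk x p → All (ValidNode G) p
  AltWalk-valid (stop v _) = v ∷ []
  AltWalk-valid (step m _ _ r) = InPhiM⇒valid m ∷ InPhiM⇒valid (InPhiM-sym m) ∷ AltWalk-valid r

  AltWalk-linked : ∀ {x p} → AltWalk x p → Linked (PhiEdge G) p
  AltWalk-linked (stop _ _) = [-]
  AltWalk-linked (step m e _ r@(stop _ _)) = InPhiM⇒PhiEdge m ∷ e ∷ AltWalk-linked r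
  AltWalk-linked (step m e _ r@(step _ _ _ _)) = InPhiM⇒PhiEdge m ∷ e ∷ AltWalk-linked r

  AltWalk-alternates : ∀ {x p} → AltWalk x p → Alternates Mt p
  unmatched-then-alternates : ∀ {y x p} → ¬ InPhiM Mt y x → AltWalk x p → Alternates Mt (y ∷ p)
  AltWalk-alternates (stop _ _) = tt
  AltWalk-alternates (step m _ ¬m r@(stop _ _)) = inj₁ (m , ¬m) , tt
  AltWalk-alternates (step m _ ¬m r@(step _ _ _ _)) = inj₁ (m , ¬m) , unmatched-then-alternates ¬m r
  unmatched-then-alternates _ (stop _ _) = tt
  unmatched-then-alternates ¬m r@(step m _ _ _) = inj₂ (¬m , m) , AltWalk-alternates r

  AltWalk-last-free : ∀ {x p} → AltWalk x p → ∀ init z → p ≡ init ++ z ∷ [] → Free z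
  AltWalk-last-free (stop _ free) [] _ refl = free
  AltWalk-last-free (stop _ _) (_ ∷ []) _ ()
  AltWalk-last-free (stop _ _) (_ ∷ _ ∷ _) _ ()
  AltWalk-last-free (step _ _ _ (stop _ _)) (_ ∷ []) _ ()
  AltWalk-last-free (step _ _ _ (step _ _ _ _)) (_ ∷ []) _ ()
  AltWalk-last-free (step _ _ _ r) (_ ∷ _ ∷ init) z eq =
    AltWalk-last-free r init z (∷-injectiveʳ (∷-injectiveʳ eq))

  AltWalk-even : ∀ {x p} → AltWalk x p → Even (pathLength p)
  AltWalk-even (stop _ _) = 0 , refl
  AltWalk-even (step _ _ _ r) with AltWalk-even r | r
  ... | k , eq | stop _ _ = suc k , cong suc (trans (cong suc eq) (sym (+-suc k k)))
  ... | k , eq | step _ _ _ _ = suc k , cong suc (trans (cong suc eq) (sym (+-suc k k)))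

  AltWalk⇒path : ∀ {x p} → AltWalk x p → Unique p → IsEvenAltPathFrom Mt x p
  AltWalk⇒path {x} {p} A p! =
    (starts-at-x A , (AltWalk-valid A , p! , AltWalk-linked A) , AltWalk-alternates A ,
     matched-edge-first A , λ init z y eq m → contradiction m (AltWalk-last-free A init z eq y)) ,
    AltWalk-even A
    where
    starts-at-x : ∀ {x p} → AltWalk x p → ∃ λ rest → p ≡ x ∷ rest
    starts-at-x (stop _ _) = _ , refl
    starts-at-x (step _ _ _ _) = _ , refl
    matched-edge-first : ∀ {x p} → AltWalk x p → ∀ y → InPhiM Mt x y →
      ∃ λ rest → p ≡ x ∷ y ∷ rest
    matched-edge-first (stop _ free) y m = contradiction m (free y)
    matched-edge-first (step m _ _ _) y m′ rewrite InPhiM-functional m m′ = _ , refl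

  MatchedEnd : List (Node n) → Set
  MatchedEnd p = ∀ init z y → p ≡ init ++ z ∷ [] → InPhiM Mt z y →
                 ∃ λ init′ → p ≡ init′ ++ y ∷ z ∷ []

  matched-then-unmatched : ∀ {x y z} → InPhiM Mt x y →
    (InPhiM Mt x y × ¬ InPhiM Mt y z) ⊎ (¬ InPhiM Mt x y × InPhiM Mt y z) → ¬ InPhiM Mt y z
  matched-then-unmatched _ (inj₁ (_ , ¬yz)) = ¬yz
  matched-then-unmatched xy (inj₂ (¬xy , _)) = contradiction xy ¬xy

  unmatched-then-matched : ∀ {x y z} → ¬ InPhiM Mt x y →
    (InPhiM Mt x y × ¬ InPhiM Mt y z) ⊎ (¬ InPhiM Mt x y × InPhiM Mt y z) → InPhiM Mt y z
  unmatched-then-matched ¬xy (inj₁ (xy , _)) = contradiction xy ¬xy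
  unmatched-then-matched _ (inj₂ (_ , yz)) = yz

  -- pre is the part of the path already consumed, kept so that MatchedEnd stays about the whole path.
  suffix⇒AltWalk : ∀ pre {x y} rest → InPhiM Mt x y →
    All (ValidNode G) (x ∷ y ∷ rest) → Linked (PhiEdge G) (x ∷ y ∷ rest) →
    Alternates Mt (x ∷ y ∷ rest) →
    Odd (length rest) → MatchedEnd (pre ++ x ∷ y ∷ rest) → ∃ (AltWalk x)
  suffix⇒AltWalk pre [] _ _ _ _ (_ , ()) _
  suffix⇒AltWalk pre {x} {y} (z ∷ []) xy (_ ∷ _ ∷ vz ∷ []) (_ ∷ yz ∷ _) (alt , _) _ end
    with free? z | matched-then-unmatched xy alt
  ... | inj₁ free | ¬yz = _ , step xy yz ¬yz (stop vz free)
  ... | inj₂ (y′ , zy′) | ¬yz = contradiction (InPhiM-sym (subst (InPhiM Mt z) y′≡y zy′)) ¬yz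
    where
    ends-with-y′z : ∃ λ init′ → pre ++ x ∷ y ∷ z ∷ [] ≡ init′ ++ y′ ∷ z ∷ []
    ends-with-y′z = end (pre ++ x ∷ y ∷ []) z y′ (sym (++-assoc pre _ _)) zy′
    y′≡y : y′ ≡ y
    y′≡y = penultimate-injective (proj₁ ends-with-y′z) (pre ++ x ∷ [])
             (trans (sym (proj₂ ends-with-y′z)) (sym (++-assoc pre _ _)))
  suffix⇒AltWalk pre {x} {y} (z ∷ y″ ∷ rest) xy (_ ∷ _ ∷ valid@(vz ∷ _)) (_ ∷ yz ∷ links)
                 (alt , alt′ , alts) (k , odd) end
    with free? z | matched-then-unmatched xy alt
  ... | inj₁ free | ¬yz = _ , step xy yz ¬yz (stop vz free)
  ... | inj₂ _    | ¬yz = _ , step xy yz ¬yz (proj₂ continue)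
    where
    continue : ∃ (AltWalk z)
    continue = suffix⇒AltWalk (pre ++ x ∷ y ∷ []) rest (unmatched-then-matched ¬yz alt′) valid links alts
                 (Even-suc⇒Odd (k , suc-injective odd)) (subst MatchedEnd (sym (++-assoc pre _ _)) end)

  path⇒AltWalk : ∀ {x p} → ValidNode G x → IsEvenAltPathFrom Mt x p → ∃ (AltWalk x)
  path⇒AltWalk {x} v ((_ , (valid , _ , links) , alts , first , end) , (k , even)) with free? x
  ... | inj₁ free = _ , stop v free
  ... | inj₂ (y , xy) with first y xy
  ...   | rest , refl = suffix⇒AltWalk [] rest xy valid links alts (Even-suc⇒Odd (k , even)) end

module Shift {n : ℕ} (G : WBGraph n) (Mt : Matching G) where
  open Unfolded G Mt
  open Alternating G Mt

  shift : ℕ → ∀ {x p} → AltWalk x p → List (Node n)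
  shift δ (stop {g , a} _ _) = (g , a + δ) ∷ []
  shift δ (step {g , a} {h , b} _ _ _ r) with a + δ ≤? w G g h
  ... | yes _ = (g , a + δ) ∷ (h , b ∸ δ) ∷ shift δ r
  ... | no _  = (g , a + δ) ∷ []

  shift-AltWalk : ∀ δ {g a p} (A : AltWalk (g , a) p) → a + δ ≤ α G g → AltWalk (g , a + δ) (shift δ A)
  shift-AltWalk δ {a = a} (stop (1≤a , _) free) a+δ≤α =
    stop (≤-trans 1≤a (m≤m+n a δ) , a+δ≤α) (free-shift δ 1≤a free)
  shift-AltWalk δ {g} {a} (step {y = h , b} {z = g′ , c} m e ¬m r) a+δ≤α with a + δ ≤? w G g h
  ... | no a+δ≰w =
    stop (≤-trans (proj₁ (InPhiM⇒valid m)) (m≤m+n a δ) , a+δ≤α) (free-above (proj₁ m) (≰⇒> a+δ≰w))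
  ... | yes a+δ≤w with InPhiM-shift δ m a+δ≤w
  ...   | δ<b , m′ = step m′ e′ (unmatched-edge e ¬m) (shift-AltWalk δ r (proj₂ (PhiEdge⇒validʳ e′)))
    where
    e′ : PhiEdge G (h , b ∸ δ) (g′ , c + δ)
    e′ = PhiEdge-shift δ e δ<b

  shift-∈ : ∀ δ {x p} (A : AltWalk x p) {g c} → (g , c) ∈ shift δ A →
    (∃ λ a → (g , a) ∈ p × c ≡ a + δ) ⊎ (g , c + δ) ∈ p
  shift-∈ δ (stop _ _) (here refl) = inj₁ (_ , here refl , refl)
  shift-∈ δ (step {g , a} {h , b} {p = p} m _ _ r) i with a + δ ≤? w G g h | i
  ... | no _      | here refl = inj₁ (a , here refl , refl)
  ... | yes _     | here refl = inj₁ (a , here refl , refl)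
  ... | yes a+δ≤w | there (here refl) =
    inj₂ (subst (λ b′ → (h , b′) ∈ (g , a) ∷ (h , b) ∷ p) (sym (m∸n+n≡m δ≤b)) (there (here refl)))
    where
    δ≤b : δ ≤ b
    δ≤b = <⇒≤ (proj₁ (InPhiM-shift δ m a+δ≤w))
  ... | yes _     | there (there j) =
    Sum.map (Prod.map₂ (Prod.map₁ (there ∘ there))) (there ∘ there) (shift-∈ δ r j)

  shift-prefix : ∀ δ {x p} (A : AltWalk x p) → ∃ λ rest → map proj₁ p ≡ map proj₁ (shift δ A) ++ rest
  shift-prefix δ (stop _ _) = [] , refl
  shift-prefix δ (step {g , a} {h , b} {p = p} _ _ _ r) with a + δ ≤? w G g h
  ... | yes _ = Prod.map₂ (cong (λ l → g ∷ h ∷ l)) (shift-prefix δ r)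
  ... | no _  = h ∷ map proj₁ p , refl

  GSimple : List (Node n) → Set
  GSimple q = Unique (map proj₁ q)

  shift-GSimple : ∀ δ {x p} (A : AltWalk x p) → GSimple p → GSimple (shift δ A)
  shift-GSimple δ A p! with shift-prefix δ A
  ... | rest , eq = proj₁ (Unique-++⁻ _ (subst Unique eq p!))

  shifts-disjoint : ∀ {x p} (A : AltWalk x p) → GSimple p → ∀ δ δ′ {y} →
    y ∈ shift δ A → y ∈ shift δ′ A → δ ≡ δ′
  shifts-disjoint A p! δ δ′ {v , c} i i′ with shift-∈ δ A i | shift-∈ δ′ A i′
  ... | inj₁ (k , j , c≡k+δ) | inj₁ (k′ , j′ , c≡k′+δ′) =
    +-cancelˡ-≡ k δ δ′
      (trans (sym c≡k+δ) (trans c≡k′+δ′ (cong (_+ δ′) (Unique-proj₁⇒functional p! j′ j))))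
  ... | inj₁ (k , j , c≡k+δ) | inj₂ j′ =
    m≡n+o∧n≡m+p⇒o≡p c≡k+δ (Unique-proj₁⇒functional p! j j′)
  ... | inj₂ j | inj₁ (k′ , j′ , c≡k′+δ′) =
    sym (m≡n+o∧n≡m+p⇒o≡p c≡k′+δ′ (Unique-proj₁⇒functional p! j′ j))
  ... | inj₂ j | inj₂ j′ = +-cancelˡ-≡ c δ δ′ (Unique-proj₁⇒functional p! j j′)

module Shortcut {n : ℕ} (G : WBGraph n) (Mt : Matching G) where
  open MatchingWeight G
  open Unfolded G Mt
  open Alternating G Mt
  open Shift G Mt
  open import Data.List.Membership.DecPropositional (_≟_ {n}) using (_∈?_)

  data AltSegment : Node n → Node n → List (Node n) → Set where
    []   : ∀ {t} → AltSegment t t []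
    step : ∀ {x y z t pre} → InPhiM Mt x y → PhiEdge G y z → ¬ InPhiM Mt y z → AltSegment z t pre →
           AltSegment x t (x ∷ y ∷ pre)

  matchedEdges : ∀ {x t pre} → AltSegment x t pre → Edges
  matchedEdges [] = []
  matchedEdges (step {x} {y} _ _ _ s) = (proj₁ x , proj₁ y) ∷ matchedEdges s

  unmatchedEdges : ∀ {x t pre} → AltSegment x t pre → Edges
  unmatchedEdges [] = []
  unmatchedEdges (step {y = y} {z} _ _ _ s) = (proj₁ y , proj₁ z) ∷ unmatchedEdges s

  endpoints-matchedEdges : ∀ {x t pre} (s : AltSegment x t pre) → endpoints (matchedEdges s) ≡ map proj₁ pre
  endpoints-matchedEdges [] = refl
  endpoints-matchedEdges (step _ _ _ s) = cong (λ l → _ ∷ _ ∷ l) (endpoints-matchedEdges s)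

  endpoints-unmatchedEdges : ∀ {x t pre} (s : AltSegment x t pre) →
    proj₁ x ∷ endpoints (unmatchedEdges s) ≡ map proj₁ pre ++ proj₁ t ∷ []
  endpoints-unmatchedEdges [] = refl
  endpoints-unmatchedEdges (step _ _ _ s) = cong (λ l → _ ∷ _ ∷ l) (endpoints-unmatchedEdges s)

  matchedEdges-matched : ∀ {x t pre} (s : AltSegment x t pre) →
    All (λ e → uncurry (M Mt) e ≡ true) (matchedEdges s)
  matchedEdges-matched [] = []
  matchedEdges-matched (step m _ _ s) = proj₁ m ∷ matchedEdges-matched s

  unmatchedEdges-edges : ∀ {x t pre} (s : AltSegment x t pre) →
    All (λ e → 0 < uncurry (w G) e) (unmatchedEdges s)
  unmatchedEdges-edges [] = []
  unmatchedEdges-edges (step _ e _ s) = proj₁ e ∷ unmatchedEdges-edges s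

  -- Along an edge the two copy indices sum to its weight + 1, so a matched edge followed by an
  -- unmatched one changes the copy index by the difference of their weights.
  copy-telescope : ∀ {x t pre} (s : AltSegment x t pre) →
    proj₂ t + totalWeight (matchedEdges s) ≡ proj₂ x + totalWeight (unmatchedEdges s)
  copy-telescope [] = refl
  copy-telescope {t = t} (step {g , a} {h , b} {g′ , c} m e _ s) = begin
    proj₂ t + (w G g h + P)  ≡⟨ x∙yz≈y∙xz (proj₂ t) (w G g h) P ⟩
    w G g h + (proj₂ t + P)  ≡⟨ cong (w G g h +_) (copy-telescope s) ⟩
    w G g h + (c + N)        ≡⟨ sym (+-assoc (w G g h) c N) ⟩
    w G g h + c + N          ≡⟨ cong (_+ N) whg+c≡a+whg′ ⟩
    a + w G h g′ + N         ≡⟨ +-assoc a (w G h g′) N ⟩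
    a + (w G h g′ + N)       ∎
    where
    open ≡-Reasoning
    P N : ℕ
    P = totalWeight (matchedEdges s)
    N = totalWeight (unmatchedEdges s)
    whg+c≡a+whg′ : w G g h + c ≡ a + w G h g′
    whg+c≡a+whg′ = suc-injective (begin
      suc (w G g h) + c  ≡⟨ cong (_+ c) (sym (proj₂ (proj₂ (proj₂ m)))) ⟩
      a + b + c          ≡⟨ +-assoc a b c ⟩
      a + (b + c)        ≡⟨ cong (a +_) (proj₂ (proj₂ (proj₂ e))) ⟩
      a + suc (w G h g′) ≡⟨ +-suc a (w G h g′) ⟩
      suc (a + w G h g′) ∎)

  -- A closed segment through distinct nodes of G is an alternating cycle of G, and exchanging its
  -- matched and unmatched edges in M cannot increase the weight.
  cycle-copy-≤ : IsMaxWeight G Mt → ∀ {g a a′ pre} → AltSegment (g , a) (g , a′) pre →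
    Unique (map proj₁ pre) → a′ ≤ a
  cycle-copy-≤ max [] _ = ≤-refl
  cycle-copy-≤ max {g} {a} {a′} s@(step {y = y} {pre = pre} _ _ _ _) pre! = +-cancelʳ-≤ _ a′ a (begin
    a′ + totalWeight Ps  ≡⟨ copy-telescope s ⟩
    a + totalWeight Ns   ≤⟨ +-monoʳ-≤ a (Exchange.totalWeight-≤ Mt Ps Ns (matchedEdges-matched s)
                              (unmatchedEdges-edges s) Ps! Ns! Ns⊆Ps max) ⟩
    a + totalWeight Ps   ∎)
    where
    open ≤-Reasoning
    Ps Ns : Edges
    Ps = matchedEdges s
    Ns = unmatchedEdges s
    L : List (Fin n)
    L = map proj₁ (y ∷ pre)
    Ps-endpoints : endpoints Ps ≡ g ∷ L
    Ps-endpoints = endpoints-matchedEdges s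
    Ns-endpoints : endpoints Ns ≡ L ++ g ∷ []
    Ns-endpoints = ∷-injectiveʳ (endpoints-unmatchedEdges s)
    Ps! : Unique (endpoints Ps)
    Ps! = subst Unique (sym Ps-endpoints) pre!
    Ns! : Unique (endpoints Ns)
    Ns! = subst Unique (sym Ns-endpoints) (Unique-rotate L pre!)
    Ns⊆Ps : ∀ {v} → v ∈ endpoints Ns → v ∈ endpoints Ps
    Ns⊆Ps {v} i with ∈-++⁻ L (subst (v ∈_) Ns-endpoints i)
    ... | inj₁ j = subst (v ∈_) (sym Ps-endpoints) (there j)
    ... | inj₂ (here refl) = subst (v ∈_) (sym Ps-endpoints) (here refl)

  alternate-sides : ∀ {x y z} → InPhiM Mt x y → PhiEdge G y z → side G (proj₁ x) ≡ side G (proj₁ z)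
  alternate-sides m e = ≢∧≢⇒≡ (InPhiM-sides m) (PhiEdge-sides e)

  split-at : ∀ {z q} → AltWalk z q → ∀ {v k} → (v , k) ∈ q → side G v ≡ side G (proj₁ z) →
    ∃₂ λ pre q₂ → q ≡ pre ++ q₂ × AltSegment z (v , k) pre × AltWalk (v , k) q₂
  split-at A@(stop _ _) (here refl) _ = [] , _ , refl , [] , A
  split-at A@(step _ _ _ _) (here refl) _ = [] , _ , refl , [] , A
  split-at (step m _ _ _) (there (here refl)) same = contradiction (sym same) (InPhiM-sides m)
  split-at (step {x} {y} m e ¬m r) (there (there i)) same with split-at r i (trans same (alternate-sides m e))
  ... | pre , q₂ , refl , s , A₂ = x ∷ y ∷ pre , q₂ , refl , step m e ¬m s , A₂

  partner-∈ : ∀ {z} pre {q₂} → AltWalk z (pre ++ q₂) → ∀ {g h k} → (h , k) ∈ pre →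
    side G h ≢ side G (proj₁ z) → M Mt g h ≡ true → g ∈ map proj₁ pre
  partner-∈ (_ ∷ []) (stop _ _) (here refl) opposite _ = contradiction refl opposite
  partner-∈ (_ ∷ []) (step _ _ _ _) (here refl) opposite _ = contradiction refl opposite
  partner-∈ (_ ∷ _ ∷ _) (step _ _ _ _) (here refl) opposite _ = contradiction refl opposite
  partner-∈ (x ∷ _ ∷ _) (step m _ _ _) {g} {h} (there (here refl)) _ gh =
    here (M-uniq Mt h g (proj₁ x) (trans (M-sym Mt h g) gh) (trans (M-sym Mt h (proj₁ x)) (proj₁ m)))
  partner-∈ (_ ∷ _ ∷ pre) (step m e _ r) (there (there i)) opposite gh =
    there (there (partner-∈ pre r i (λ same → opposite (trans same (sym (alternate-sides m e)))) gh))

  partner-∉ : ∀ {z} pre {q₂ g h} → AltWalk z (pre ++ q₂) → M Mt g h ≡ true →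
    side G g ≡ side G (proj₁ z) → g ∉ map proj₁ pre → h ∉ map proj₁ pre
  partner-∉ pre A gh same g∉ h∈ with ∈-map⁻ proj₁ h∈
  ... | (h , k) , i , refl =
    g∉ (partner-∈ pre A i (λ same′ → bipart G _ h (M-edge Mt _ h gh) (trans same (sym same′))) gh)

  reroute : IsMaxWeight G Mt → ∀ {g a h b z pre q₂ a′} →
    InPhiM Mt (g , a) (h , b) → PhiEdge G (h , b) z → ¬ InPhiM Mt (h , b) z →
    AltWalk z (pre ++ q₂) → GSimple (pre ++ q₂) → AltSegment z (g , a′) pre → AltWalk (g , a′) q₂ →
    ∃ λ q → AltWalk (g , a) q × GSimple q
  reroute max {g} {a} {h} {pre = pre} {q₂} {a′} m e ¬m A q! s A₂ =
    shift δ A₂ ,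
    subst (λ c → AltWalk (g , c) (shift δ A₂)) (m+[n∸m]≡n a′≤a) (shift-AltWalk δ A₂ a′+δ≤α) ,
    shift-GSimple δ A₂ q₂!
    where
    L : List (Fin n)
    L = map proj₁ pre
    split! : Unique L × GSimple q₂ × (∀ {v} → v ∈ L → v ∉ map proj₁ q₂)
    split! = Unique-++⁻ L (subst Unique (map-++ proj₁ pre q₂) q!)
    q₂! : GSimple q₂
    q₂! = proj₁ (proj₂ split!)
    g∉L : g ∉ L
    g∉L g∈L = proj₂ (proj₂ split!) g∈L (∈-map⁺ proj₁ (AltWalk-head-∈ A₂))
    cycle! : Unique (g ∷ h ∷ L)
    cycle! = Unique-∷∷ (InPhiM-sides m ∘ cong (side G)) g∉L
               (partner-∉ pre A (proj₁ m) (alternate-sides m e) g∉L) (proj₁ split!)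
    a′≤a : a′ ≤ a
    a′≤a = cycle-copy-≤ max (step m e ¬m s) cycle!
    δ : ℕ
    δ = a ∸ a′
    a′+δ≤α : a′ + δ ≤ α G g
    a′+δ≤α = subst (_≤ α G g) (sym (m+[n∸m]≡n a′≤a)) (proj₂ (InPhiM⇒valid m))

  shortcut : IsMaxWeight G Mt → ∀ {x p} → AltWalk x p → ∃ λ q → AltWalk x q × GSimple q
  shortcut max (stop v free) = _ , stop v free , [] ∷ []
  shortcut max (step {g , a} {h , b} m e ¬m r) with shortcut max r
  ... | q , A , q! with g ∈? map proj₁ q
  ...   | no g∉q = _ , step m e ¬m A ,
    Unique-∷∷ (InPhiM-sides m ∘ cong (side G)) g∉q
      (partner-∉ q (subst (AltWalk _) (sym (++-identityʳ q)) A) (proj₁ m) (alternate-sides m e) g∉q) q!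
  ...   | yes g∈q with ∈-map⁻ proj₁ g∈q
  ...     | (g , a′) , i , refl with split-at A i (alternate-sides m e)
  ...       | pre , q₂ , refl , s , A₂ = reroute max m e ¬m A q! s A₂

lemma4p2 : ∀ {n} (G : WBGraph n) (Mt : Matching G) → IsMaxWeight G Mt →
    (u : Fin n) (i : ℕ) → 1 ≤ i → i ≤ α G u →
    ρ≡0 Mt (u , i) →
    (∀ j → i ≤ j → j ≤ α G u → ρ≡0 Mt (u , j))
    × (Σ (ℕ → List (Node n)) λ P →
        (∀ j → i ≤ j → j ≤ α G u → IsEvenAltPathFrom Mt (u , j) (P j))
        × (∀ j k → i ≤ j → j ≤ α G u → i ≤ k → k ≤ α G u → j ≢ k →
             Disjoint (P j) (P k)))
lemma4p2 {n} G Mt max u i 1≤i i≤α (_ , path) =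
  (λ j i≤j j≤α → P j , P-path j i≤j j≤α) , P , P-path , P-disjoint
  where
  open Alternating G Mt
  open Shift G Mt
  open Shortcut G Mt
  simple : ∃ λ q → AltWalk (u , i) q × GSimple q
  simple = shortcut max (proj₂ (path⇒AltWalk (1≤i , i≤α) path))
  A : AltWalk (u , i) (proj₁ simple)
  A = proj₁ (proj₂ simple)
  A! : GSimple (proj₁ simple)
  A! = proj₂ (proj₂ simple)
  P : ℕ → List (Node n)
  P j = shift (j ∸ i) A
  P-path : ∀ j → i ≤ j → j ≤ α G u → IsEvenAltPathFrom Mt (u , j) (P j)
  P-path j i≤j j≤α =
    AltWalk⇒path (subst (λ c → AltWalk (u , c) (P j)) i+[j∸i]≡j walk) (map⁻ (shift-GSimple (j ∸ i) A A!))
    where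
    i+[j∸i]≡j : i + (j ∸ i) ≡ j
    i+[j∸i]≡j = m+[n∸m]≡n i≤j
    walk : AltWalk (u , i + (j ∸ i)) (P j)
    walk = shift-AltWalk (j ∸ i) A (subst (_≤ α G u) (sym i+[j∸i]≡j) j≤α)
  P-disjoint : ∀ j k → i ≤ j → j ≤ α G u → i ≤ k → k ≤ α G u → j ≢ k → Disjoint (P j) (P k)
  P-disjoint j k i≤j _ i≤k _ j≢k _ y∈Pj y∈Pk =
    j≢k (∸-cancelʳ-≡ i≤j i≤k (shifts-disjoint A A! (j ∸ i) (k ∸ i) y∈Pj y∈Pk))
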